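{- Let $G'=(V',E')$ be a graph, $V\subsetneq V'$, $G=G'[V]$, and let $S$ be a power dominating set of $G$. Let $t$ be the number of isolated vertices of $G'[V'\setminus V]$. Then \[\gamma_P(G';S)\le |S|+\frac{|V'\setminus V|}{2}+\frac{t}{2},\] and this bound is tight, i.e., there exist such $G'$, $V$, $S$ for which equality holds.
   Context: All graphs are finite, simple and undirected; $H[W]$ is the subgraph of $H$ induced by $W$. $N(v)$ denotes the set of neighbors of $v$, $N[v]=N(v)\cup\{v\}$, $N[S]=\bigcup_{v\in S}N[v]$. For $S\subseteq V(H)$, the set $PD(S)$ is defined by: initially $PD(S)=N[S]$; while there exists $v\in PD(S)$ with $|N(v)\setminus PD(S)|=1$, replace $PD(S)$ by $PD(S)\cup N(v)$. $S$ is a power dominating set of $H$ if at the end $PD(S)=V(H)$. $\gamma_P(H;X)$ is the minimum size of a power dominating set of $H$ containing $X$. -}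

module Defs where

open import Data.Nat using (ℕ; _+_; _*_; _≤_)
open import Data.Bool using (Bool; true; false; not; _∨_)
open import Data.Fin using (Fin)
open import Data.Fin.Subset using (Subset; _∈_; _∉_; _⊆_; ⊤; ∁; ∣_∣)
open import Data.List using (List; []; _∷_; allFin)
open import Data.Vec using (tabulate; lookup)
open import Data.Product using (Σ; _×_; ∃)
open import Relation.Binary.PropositionalEquality using (_≡_; _≢_)

record Graph (n : ℕ) : Set where
  field
    adj    : Fin n → Fin n → Bool
    sym    : ∀ i j → adj i j ≡ adj j i
    irrefl : ∀ i → adj i i ≡ false

open Graph public

Adj : ∀ {n} → Graph n → Fin n → Fin n → Set
Adj G i j = adj G i j ≡ true

-- Observed G W S v : v ∈ PD(S) computed in the induced subgraph G[W]
-- (PD(S) is the least set containing N[S] and closed under the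
--  propagation rule, i.e. exactly the final set of the iterative process).
data Observed {n : ℕ} (G : Graph n) (W S : Subset n) : Fin n → Set where
  self  : ∀ {v} → v ∈ W → v ∈ S → Observed G W S v
  nbr   : ∀ {u v} → u ∈ S → v ∈ W → Adj G u v → Observed G W S v
  force : ∀ {u v} → Observed G W S u → v ∈ W → Adj G u v →
          (∀ x → x ∈ W → Adj G u x → x ≢ v → Observed G W S x) →
          Observed G W S v

IsPDS : ∀ {n} → Graph n → Subset n → Subset n → Set
IsPDS G W S = S ⊆ W × (∀ v → v ∈ W → Observed G W S v)

IsPDSfull : ∀ {n} → Graph n → Subset n → Set
IsPDSfull {n} G S = IsPDS G ⊤ S

allB : {A : Set} → (A → Bool) → List A → Bool
allB p [] = true
allB p (x ∷ xs) = p x Data.Bool.∧ allB p xs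

isolatedOutside : ∀ {n} → Graph n → Subset n → Fin n → Bool
isolatedOutside {n} G V v =
  not (lookup V v) Data.Bool.∧ allB (λ u → lookup V u ∨ not (adj G v u)) (allFin n)

isoCount : ∀ {n} → Graph n → Subset n → ℕ
isoCount {n} G V = ∣ tabulate (isolatedOutside G V) ∣

-- twice the bound  |S| + |V'∖V|/2 + t/2
twiceBound : ∀ {n} → Graph n → Subset n → Subset n → ℕ
twiceBound G V S = 2 * ∣ S ∣ + ∣ ∁ V ∣ + isoCount G V

-- Keep S and add every isolated vertex I of G'[V'∖V]. The remaining vertices
-- U of V'∖V induce a graph without isolated vertices, so by Ore's theorem
-- G'[U] has a dominating set D with |D| ≤ |U|/2: for a minimal dominating set
-- D, the complement U∖D dominates too. Then S ∪ I ∪ D observes V'∖V in the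
-- domination step, after which every propagation step of G[V] remains valid
-- in G', since the neighbours of a vertex of V that lie outside V are already
-- observed. Equality holds for the one-vertex graph with V = S = ∅.
module Submission where

open import Defs
open import Data.Bool using (Bool; true; false; not; _∧_; _∨_)
import Data.Bool as Bool
open import Data.Bool.Properties using (∧-conicalˡ; ∧-conicalʳ; ∨-conicalˡ; ∨-conicalʳ; not-injective)
open import Data.Fin using (Fin; zero; _≟_)
open import Data.Fin.Properties using (any?; all?; ¬∀⟶∃¬)
open import Data.Fin.Subset using (Subset; _∈_; _∉_; _⊆_; ∣_∣; ⊤; ∁; _∪_; _─_; _-_; inside; outside)
  renaming (⊥ to ∅)
open import Data.Fin.Subset.Properties
  using (_∈?_; ∈⊤; ⊆⊤; drop-∷-⊆; ∣p∣≤∣x∷p∣; p⊆p∪q; q⊆p∪q; p─q⊆p; x∈p∧x∉q⇒x∈p─q;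
         x∈p∧x≢y⇒x∈p-y; x∈p⇒p-x⊂p; x∈∁p⇒x∉p; x∉p⇒x∈∁p)
open import Data.Fin.Subset.Induction using (Acc; acc; ⊂-wellFounded)
open import Data.List using ([]; _∷_; allFin)
open import Data.List.Membership.Propositional using () renaming (_∈_ to _∈ₗ_)
open import Data.List.Membership.Propositional.Properties using (∈-allFin)
open import Data.List.Relation.Unary.Any using (here; there)
open import Data.Nat using (ℕ; suc; _+_; _*_; _≤_; z≤n; s≤s; _≤?_)
open import Data.Nat.Properties
  using (≤-refl; ≤-trans; ≤-reflexive; +-comm; +-suc; +-identityʳ; +-monoʳ-≤; *-monoʳ-≤; ≰⇒≥;
         module ≤-Reasoning)
open import Data.Nat.Solver using (module +-*-Solver)
open import Data.Product using (Σ; _×_; ∃; _,_; proj₁)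
open import Data.Sum using (_⊎_; inj₁; inj₂)
open import Data.Vec using ([]; _∷_; lookup; tabulate; here; there)
open import Data.Vec.Properties using (lookup∘tabulate; []=⇒lookup; lookup⇒[]=)
open import Function using (id; _∘_)
open import Relation.Nullary using (¬_; Dec; yes; no; contradiction; decidable-stable)
open import Relation.Nullary.Decidable using (_⊎-dec_; _×-dec_; _→-dec_)
open import Relation.Binary.PropositionalEquality using (_≡_; _≢_; refl; trans; cong; cong₂; subst)
import Relation.Binary.PropositionalEquality as ≡

∣p∪q∣≤∣p∣+∣q∣ : ∀ {n} (p q : Subset n) → ∣ p ∪ q ∣ ≤ ∣ p ∣ + ∣ q ∣
∣p∪q∣≤∣p∣+∣q∣ []            []            = z≤n
∣p∪q∣≤∣p∣+∣q∣ (outside ∷ p) (outside ∷ q) = ∣p∪q∣≤∣p∣+∣q∣ p q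
∣p∪q∣≤∣p∣+∣q∣ (outside ∷ p) (inside  ∷ q) =
  ≤-trans (s≤s (∣p∪q∣≤∣p∣+∣q∣ p q)) (≤-reflexive (≡.sym (+-suc ∣ p ∣ ∣ q ∣)))
∣p∪q∣≤∣p∣+∣q∣ (inside  ∷ p) (t       ∷ q) =
  s≤s (≤-trans (∣p∪q∣≤∣p∣+∣q∣ p q) (+-monoʳ-≤ ∣ p ∣ (∣p∣≤∣x∷p∣ t q)))

p⊆q⇒∣q─p∣+∣p∣≡∣q∣ : ∀ {n} {p q : Subset n} → p ⊆ q → ∣ q ─ p ∣ + ∣ p ∣ ≡ ∣ q ∣
p⊆q⇒∣q─p∣+∣p∣≡∣q∣ {p = []}          {[]}          p⊆q = refl
p⊆q⇒∣q─p∣+∣p∣≡∣q∣ {p = outside ∷ p} {outside ∷ q} p⊆q = p⊆q⇒∣q─p∣+∣p∣≡∣q∣ (drop-∷-⊆ p⊆q)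
p⊆q⇒∣q─p∣+∣p∣≡∣q∣ {p = outside ∷ p} {inside  ∷ q} p⊆q = cong suc (p⊆q⇒∣q─p∣+∣p∣≡∣q∣ (drop-∷-⊆ p⊆q))
p⊆q⇒∣q─p∣+∣p∣≡∣q∣ {p = inside  ∷ p} {inside  ∷ q} p⊆q =
  trans (+-suc ∣ q ─ p ∣ ∣ p ∣) (cong suc (p⊆q⇒∣q─p∣+∣p∣≡∣q∣ (drop-∷-⊆ p⊆q)))
p⊆q⇒∣q─p∣+∣p∣≡∣q∣ {p = inside  ∷ p} {outside ∷ q} p⊆q with p⊆q here
... | ()

2*m≤m+n : ∀ {m n} → m ≤ n → 2 * m ≤ m + n
2*m≤m+n {m} m≤n = +-monoʳ-≤ m (≤-trans (≤-reflexive (+-identityʳ m)) m≤n)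

lookup≡false⇒∉ : ∀ {n} {p : Subset n} {x} → lookup p x ≡ false → x ∉ p
lookup≡false⇒∉ p[x]≡false x∈p with trans (≡.sym ([]=⇒lookup x∈p)) p[x]≡false
... | ()

∉⇒lookup≡false : ∀ {n} {p : Subset n} {x} → x ∉ p → lookup p x ≡ false
∉⇒lookup≡false {p = p} {x} x∉p with lookup p x in p[x]
... | true  = contradiction (lookup⇒[]= x p p[x]) x∉p
... | false = refl

x∈p─q⇒x∉q : ∀ {n} {x} (p q : Subset n) → x ∈ p ─ q → x ∉ q
x∈p─q⇒x∉q (inside ∷ p) (outside ∷ q) here       ()
x∈p─q⇒x∉q (_      ∷ p) (_       ∷ q) (there x∈) (there x∈q) = x∈p─q⇒x∉q p q x∈ x∈q

allB-true⇒ : ∀ {A : Set} (f : A → Bool) {xs x} → allB f xs ≡ true → x ∈ₗ xs → f x ≡ true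
allB-true⇒ f {y ∷ ys} all-true (here refl) = ∧-conicalˡ (f y) _ all-true
allB-true⇒ f {y ∷ ys} all-true (there x∈)  = allB-true⇒ f (∧-conicalʳ (f y) _ all-true) x∈

allB-false⇒ : ∀ {A : Set} (f : A → Bool) {xs} → allB f xs ≡ false → ∃ λ x → f x ≡ false
allB-false⇒ f {y ∷ ys} all-false with f y in fy
... | false = y , fy
... | true  = allB-false⇒ f {ys} all-false

module _ {n} (G : Graph n) where

  Dominated : Subset n → Fin n → Set
  Dominated D u = u ∈ D ⊎ ∃ λ w → w ∈ D × Adj G u w

  Dominates : Subset n → Subset n → Set
  Dominates D U = ∀ u → u ∈ U → Dominated D u

  MinimalDominating : Subset n → Subset n → Set
  MinimalDominating D U = Dominates D U × (∀ v → v ∈ D → ¬ Dominates (D - v) U)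

  IsolatedFree : Subset n → Set
  IsolatedFree U = ∀ u → u ∈ U → ∃ λ w → w ∈ U × Adj G u w

  dominated? : ∀ D u → Dec (Dominated D u)
  dominated? D u = u ∈? D ⊎-dec any? (λ w → w ∈? D ×-dec adj G u w Bool.≟ true)

  dominates? : ∀ D U → Dec (Dominates D U)
  dominates? D U = all? (λ u → u ∈? U →-dec dominated? D u)

  ¬dominates⇒undominated : ∀ {D U} → ¬ Dominates D U → ∃ λ w → w ∈ U × ¬ Dominated D w
  ¬dominates⇒undominated {D} {U} ¬dom with ¬∀⟶∃¬ n _ (λ u → u ∈? U →-dec dominated? D u) ¬dom
  ... | w , ¬dom-w =
    w , decidable-stable (w ∈? U) (λ w∉U → ¬dom-w (λ w∈U → contradiction w∈U w∉U)) , ¬dom-w ∘ λ d _ → d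

  dominates-refl : ∀ U → Dominates U U
  dominates-refl U u u∈U = inj₁ u∈U

  minimalDominatingSubset : ∀ {D U} → Dominates D U → ∃ λ D′ → D′ ⊆ D × MinimalDominating D′ U
  minimalDominatingSubset {D} = go D (⊂-wellFounded D)
    where
    go : ∀ {U} D → Acc _ D → Dominates D U → ∃ λ D′ → D′ ⊆ D × MinimalDominating D′ U
    go {U} D (acc rec) dom with any? (λ v → v ∈? D ×-dec dominates? (D - v) U)
    ... | no irreducible = D , id , dom , λ v v∈D dom-v → irreducible (v , v∈D , dom-v)
    ... | yes (v , v∈D , dom-v) with go (D - v) (rec (x∈p⇒p-x⊂p v∈D)) dom-v
    ...   | D′ , D′⊆D-v , minimal = D′ , p─q⊆p D _ ∘ D′⊆D-v , minimal

  adj-sym : ∀ {u v} → Adj G u v → Adj G v u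
  adj-sym {u} {v} u~v = trans (Graph.sym G v u) u~v

  adj⇒≢ : ∀ {u v} → Adj G u v → u ≢ v
  adj⇒≢ {u} u~v refl with trans (≡.sym (Graph.irrefl G u)) u~v
  ... | ()

  undominatedSelf : ∀ {D U u} → IsolatedFree U → u ∈ U → ¬ Dominated (D - u) u →
                    ∃ λ x → x ∈ U ─ D × Adj G u x
  undominatedSelf {D} {U} {u} isolatedFree u∈U ¬dom with isolatedFree u u∈U
  ... | x , x∈U , u~x = x , x∈p∧x∉q⇒x∈p─q x∈U x∉D , u~x
    where
    x∉D : x ∉ D
    x∉D x∈D = ¬dom (inj₂ (x , x∈p∧x≢y⇒x∈p-y x∈D (adj⇒≢ u~x ∘ ≡.sym) , u~x))

  undominatedOther : ∀ {D U u w} → Dominates D U → w ∈ U → w ≢ u → ¬ Dominated (D - u) w →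
                     w ∈ U ─ D × Adj G u w
  undominatedOther {D} {U} {u} {w} dom w∈U w≢u ¬dom with dom w w∈U
  ... | inj₁ w∈D = contradiction (inj₁ (x∈p∧x≢y⇒x∈p-y w∈D w≢u)) ¬dom
  ... | inj₂ (x , x∈D , w~x) with x ≟ u
  ...   | no x≢u   = contradiction (inj₂ (x , x∈p∧x≢y⇒x∈p-y x∈D x≢u , w~x)) ¬dom
  ...   | yes refl = x∈p∧x∉q⇒x∈p─q w∈U w∉D , adj-sym w~x
    where
    w∉D : w ∉ D
    w∉D w∈D = ¬dom (inj₁ (x∈p∧x≢y⇒x∈p-y w∈D w≢u))

  -- Ore: by minimality each u ∈ D leaves some w undominated by D - u; then
  -- w ∉ D is a neighbour of u, or w = u and u has a neighbour outside D.
  complementDominates : ∀ {D U} → IsolatedFree U → MinimalDominating D U → Dominates (U ─ D) U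
  complementDominates {D} {U} isolatedFree (dom , minimal) u u∈U with u ∈? D
  ... | no u∉D = inj₁ (x∈p∧x∉q⇒x∈p─q u∈U u∉D)
  ... | yes u∈D with ¬dominates⇒undominated (minimal u u∈D)
  ...   | w , w∈U , ¬dom-w with w ≟ u
  ...     | yes refl = inj₂ (undominatedSelf isolatedFree u∈U ¬dom-w)
  ...     | no w≢u   = inj₂ (w , undominatedOther dom w∈U w≢u ¬dom-w)

  smallDominatingSet : ∀ {U} → IsolatedFree U → ∃ λ D → D ⊆ U × Dominates D U × 2 * ∣ D ∣ ≤ ∣ U ∣
  smallDominatingSet {U} isolatedFree with minimalDominatingSubset (dominates-refl U)
  ... | D , D⊆U , minimal with ∣ D ∣ ≤? ∣ U ─ D ∣
  ...   | yes small = D , D⊆U , proj₁ minimal ,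
                      subst (2 * ∣ D ∣ ≤_) (trans (+-comm ∣ D ∣ _) (p⊆q⇒∣q─p∣+∣p∣≡∣q∣ D⊆U)) (2*m≤m+n small)
  ...   | no large  = U ─ D , p─q⊆p U D , complementDominates isolatedFree minimal ,
                      subst (2 * ∣ U ─ D ∣ ≤_) (p⊆q⇒∣q─p∣+∣p∣≡∣q∣ D⊆U) (2*m≤m+n (≰⇒≥ large))

  dominated⇒observed : ∀ {D T x} → D ⊆ T → Dominated D x → Observed G ⊤ T x
  dominated⇒observed D⊆T (inj₁ x∈D)             = self ∈⊤ (D⊆T x∈D)
  dominated⇒observed D⊆T (inj₂ (w , w∈D , x~w)) = nbr (D⊆T w∈D) ∈⊤ (adj-sym x~w)

  observed-extend : ∀ {W S T v} → S ⊆ T → (∀ x → x ∉ W → Observed G ⊤ T x) →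
                    Observed G W S v → Observed G ⊤ T v
  observed-extend S⊆T observedOutside (self _ v∈S)   = self ∈⊤ (S⊆T v∈S)
  observed-extend S⊆T observedOutside (nbr u∈S _ u~v) = nbr (S⊆T u∈S) ∈⊤ u~v
  observed-extend {W} S⊆T observedOutside (force obs-u _ u~v others) =
    force (observed-extend S⊆T observedOutside obs-u) ∈⊤ u~v observe-other
    where
    observe-other : ∀ x → x ∈ ⊤ → Adj G _ x → x ≢ _ → Observed G ⊤ _ x
    observe-other x _ u~x x≢v with x ∈? W
    ... | yes x∈W = observed-extend S⊆T observedOutside (others x x∈W u~x x≢v)
    ... | no x∉W  = observedOutside x x∉W

  isPDS-extend : ∀ {W S T} → IsPDS G W S → S ⊆ T → (∀ x → x ∉ W → Observed G ⊤ T x) → IsPDSfull G T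
  isPDS-extend {W} (_ , observed) S⊆T observedOutside = ⊆⊤ , observe
    where
    observe : ∀ v → v ∈ ⊤ → Observed G ⊤ _ v
    observe v _ with v ∈? W
    ... | yes v∈W = observed-extend S⊆T observedOutside (observed v v∈W)
    ... | no v∉W  = observedOutside v v∉W

module _ {n} (G : Graph n) (V : Subset n) where

  Isolated : Subset n
  Isolated = tabulate (isolatedOutside G V)

  NonIsolatedOutside : Subset n
  NonIsolatedOutside = ∁ V ─ Isolated

  nonAdjacentOrInside : Fin n → Fin n → Bool
  nonAdjacentOrInside v u = lookup V u ∨ not (adj G v u)

  ∈Isolated⇒isolatedOutside : ∀ {v} → v ∈ Isolated → isolatedOutside G V v ≡ true
  ∈Isolated⇒isolatedOutside {v} v∈I = trans (≡.sym (lookup∘tabulate _ v)) ([]=⇒lookup v∈I)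

  isolatedOutside⇒∈Isolated : ∀ {v} → isolatedOutside G V v ≡ true → v ∈ Isolated
  isolatedOutside⇒∈Isolated {v} iso = lookup⇒[]= v Isolated (trans (lookup∘tabulate _ v) iso)

  isolated⇒∉ : ∀ {v} → v ∈ Isolated → v ∉ V
  isolated⇒∉ {v} v∈I = lookup≡false⇒∉ (not-injective (∧-conicalˡ _ _ (∈Isolated⇒isolatedOutside v∈I)))

  isolated⇒noNeighbourOutside : ∀ {v u} → v ∈ Isolated → u ∉ V → ¬ Adj G v u
  isolated⇒noNeighbourOutside {v} {u} v∈I u∉V v~u
    with allB-true⇒ _ (∧-conicalʳ _ _ (∈Isolated⇒isolatedOutside v∈I)) (∈-allFin u)
  ... | holds with trans (≡.sym holds) (cong₂ (λ a b → a ∨ not b) (∉⇒lookup≡false u∉V) v~u)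
  ...   | ()

  ¬isolated⇒neighbourOutside : ∀ {v} → v ∉ V → v ∉ Isolated → ∃ λ u → u ∉ V × Adj G v u
  ¬isolated⇒neighbourOutside {v} v∉V v∉I with isolatedOutside G V v in iso
  ... | true  = contradiction (isolatedOutside⇒∈Isolated iso) v∉I
  ... | false with allB-false⇒ (nonAdjacentOrInside v) {allFin n}
                      (subst (λ b → not b ∧ allB (nonAdjacentOrInside v) (allFin n) ≡ false)
                             (∉⇒lookup≡false v∉V) iso)
  ...   | u , fails = u , lookup≡false⇒∉ (∨-conicalˡ _ _ fails) , not-injective (∨-conicalʳ _ _ fails)

  nonIsolated⇒∉ : ∀ {u} → u ∈ NonIsolatedOutside → u ∉ V
  nonIsolated⇒∉ u∈U = x∈∁p⇒x∉p (p─q⊆p (∁ V) Isolated u∈U)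

  nonIsolatedOutside-isolatedFree : IsolatedFree G NonIsolatedOutside
  nonIsolatedOutside-isolatedFree u u∈U
    with ¬isolated⇒neighbourOutside (nonIsolated⇒∉ u∈U) (x∈p─q⇒x∉q (∁ V) Isolated u∈U)
  ... | w , w∉V , u~w = w , x∈p∧x∉q⇒x∈p─q (x∉p⇒x∈∁p w∉V) w∉I , u~w
    where
    w∉I : w ∉ Isolated
    w∉I w∈I = isolated⇒noNeighbourOutside w∈I (nonIsolated⇒∉ u∈U) (adj-sym G u~w)

twiceBound-arithmetic : ∀ {t s i d u} → t ≤ s + (i + d) → 2 * d ≤ u → 2 * t ≤ 2 * s + (u + i) + i
twiceBound-arithmetic {t} {s} {i} {d} {u} t≤ 2d≤u = begin
  2 * t                     ≤⟨ *-monoʳ-≤ 2 t≤ ⟩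
  2 * (s + (i + d))         ≡⟨ solve 3 (λ s i d → con 2 :* (s :+ (i :+ d)) := con 2 :* s :+ i :+ i :+ con 2 :* d) refl s i d ⟩
  2 * s + i + i + 2 * d     ≤⟨ +-monoʳ-≤ (2 * s + i + i) 2d≤u ⟩
  2 * s + i + i + u         ≡⟨ solve 3 (λ s i u → con 2 :* s :+ i :+ i :+ u := con 2 :* s :+ (u :+ i) :+ i) refl s i u ⟩
  2 * s + (u + i) + i       ∎
  where
  open ≤-Reasoning
  open +-*-Solver

upperBound : ∀ {n} (G : Graph n) (V S : Subset n) → IsPDS G V S →
             Σ (Subset n) λ T → S ⊆ T × IsPDSfull G T × 2 * ∣ T ∣ ≤ twiceBound G V S
upperBound G V S pds with smallDominatingSet G (nonIsolatedOutside-isolatedFree G V)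
... | D , _ , dom , 2∣D∣≤∣U∣ = T , S⊆T , isPDS-extend G pds S⊆T observedOutside , bound
  where
  I = Isolated G V
  T = S ∪ I ∪ D

  S⊆T : S ⊆ T
  S⊆T = p⊆p∪q (I ∪ D)

  I∪D⊆T : I ∪ D ⊆ T
  I∪D⊆T = q⊆p∪q S (I ∪ D)

  observedOutside : ∀ x → x ∉ V → Observed G ⊤ T x
  observedOutside x x∉V with x ∈? I
  ... | yes x∈I = self ∈⊤ (I∪D⊆T (p⊆p∪q D x∈I))
  ... | no x∉I  = dominated⇒observed G (I∪D⊆T ∘ q⊆p∪q I D) (dom x (x∈p∧x∉q⇒x∈p─q (x∉p⇒x∈∁p x∉V) x∉I))

  ∣T∣≤ : ∣ T ∣ ≤ ∣ S ∣ + (∣ I ∣ + ∣ D ∣)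
  ∣T∣≤ = ≤-trans (∣p∪q∣≤∣p∣+∣q∣ S (I ∪ D)) (+-monoʳ-≤ ∣ S ∣ (∣p∪q∣≤∣p∣+∣q∣ I D))

  bound : 2 * ∣ T ∣ ≤ twiceBound G V S
  bound = subst (λ c → 2 * ∣ T ∣ ≤ 2 * ∣ S ∣ + c + ∣ I ∣)
                (p⊆q⇒∣q─p∣+∣p∣≡∣q∣ (x∉p⇒x∈∁p ∘ isolated⇒∉ G V))
                (twiceBound-arithmetic {s = ∣ S ∣} {∣ I ∣} {∣ D ∣} ∣T∣≤ 2∣D∣≤∣U∣)

edgeless : ∀ n → Graph n
edgeless n = record { adj = λ _ _ → false ; sym = λ _ _ → refl ; irrefl = λ _ → refl }

observed-edgeless⇒∈ : ∀ {n W S v} → Observed (edgeless n) W S v → v ∈ S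
observed-edgeless⇒∈ (self _ v∈S)  = v∈S
observed-edgeless⇒∈ (nbr _ _ ())
observed-edgeless⇒∈ (force _ _ () _)

proposition3p8 :
    (∀ (n : ℕ) (G : Graph n) (V S : Subset n) →
      (∃ λ (v : Fin n) → v ∉ V) → IsPDS G V S →
      Σ (Subset n) λ T → S ⊆ T × IsPDSfull G T × 2 * ∣ T ∣ ≤ twiceBound G V S)
    ×
    (Σ ℕ λ n → Σ (Graph n) λ G → Σ (Subset n) λ V → Σ (Subset n) λ S →
      (∃ λ (v : Fin n) → v ∉ V) × IsPDS G V S ×
      (Σ (Subset n) λ T → S ⊆ T × IsPDSfull G T × 2 * ∣ T ∣ ≡ twiceBound G V S) ×
      (∀ (T : Subset n) → S ⊆ T → IsPDSfull G T → twiceBound G V S ≤ 2 * ∣ T ∣))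
proposition3p8 =
  (λ n G V S _ → upperBound G V S) ,
  (1 , edgeless 1 , ∅ , ∅ , (zero , λ ()) , ((λ { (there ()) }) , λ { zero () }) ,
   (⊤ , ⊆⊤ , (⊆⊤ , λ { zero _ → self here here }) , refl) , lowerBound)
  where
  lowerBound : ∀ T → ∅ ⊆ T → IsPDSfull (edgeless 1) T → 2 ≤ 2 * ∣ T ∣
  lowerBound (inside  ∷ []) _ _ = ≤-refl
  lowerBound (outside ∷ []) _ (_ , observed) with observed-edgeless⇒∈ (observed zero ∈⊤)
  ... | ()
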